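{- Let $G$ be a graph with vertex set $V$, adjacency matrix $A$ and pivotal poset $\mathcal{R}_0(G)$, and let $W\subseteq V$. Then $\mathcal{R}_0(G)\oplus W$ is realizable if and only if $W\in\mathcal{R}_0(G)$. In that case, the graph realizing $\mathcal{R}_0(G)\oplus W$ has adjacency matrix $A\ast W$.
   Context: A graph is a finite graph with vertex set $V$, no multiple edges, in which each vertex may or may not carry a loop. Its adjacency matrix $A$ is the symmetric $V\times V$ matrix over $\mathbf{F}_2$ with $A_{vw}=1$ iff $v\ne w$ are adjacent and $A_{vv}=1$ iff $v$ has a loop. The pivotal poset $\mathcal{R}_0(G)$ is the set of $U\subseteq V$ such that the principal submatrix $A_{U,U}$ is invertible over $\mathbf{F}_2$ (including $U=\emptyset$); equivalently the reducible vertex sets of nullity $0$. A pair $(\mathcal{R},V)$, with $\mathcal{R}$ a collection of subsets of the finite set $V$, is realizable if there is a graph on vertex set $V$ whose pivotal poset is $\mathcal{R}$. For a collection $\mathcal{S}$ of subsets of $V$ and $X\subseteq V$, $\mathcal{S}\oplus X=\{Y\oplus X:Y\in\mathcal{S}\}$, where $\oplus$ is symmetric difference. Pivot: if $A_{X,X}$ is invertible, ordering $X$ first and writing $A=\begin{pmatrix}P&Q\\ Q^T&R\end{pmatrix}$ with $P=A_{X,X}$, $A\ast X=\begin{pmatrix}P^{ -1}&P^{ -1}Q\\ Q^TP^{ -1}&R-Q^TP^{ -1}Q\end{pmatrix}$ (over $\mathbf{F}_2$, so signs are irrelevant). -}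

module Defs where

open import Data.Nat using (ℕ; zero; suc)
open import Data.Bool using (Bool; true; false; _xor_; _∧_; if_then_else_)
open import Data.Fin using (Fin; zero; suc; _≟_)
open import Data.Fin.Subset using (Subset)
open import Data.Vec using (lookup; zipWith)
import Data.Vec
open import Data.Product using (Σ; ∃; _×_; _,_)
open import Relation.Binary.PropositionalEquality using (_≡_)
open import Relation.Nullary using (does)
open import Function.Bundles using (_⇔_)

-- Matrices over F₂ = Bool (addition = xor, multiplication = ∧), indexed by the vertex set Fin n.
Matrix : ℕ → Set
Matrix n = Fin n → Fin n → Bool

-- A graph on vertex set Fin n (loops allowed, no multiple edges),
-- given by its symmetric adjacency matrix over F₂.
record Graph (n : ℕ) : Set where
  constructor graph
  field
    adj  : Matrix n
    symm : ∀ i j → adj i j ≡ adj j i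
open Graph public

mem : ∀ {n} → Subset n → Fin n → Bool
mem U i = lookup U i

ΣF : ∀ {n} → Subset n → (Fin n → Bool) → Bool
ΣF {zero}  U f = false
ΣF {suc n} U f = (mem U zero ∧ f zero) xor ΣF {n} (Data.Vec.tail U) (λ k → f (suc k))

δ : ∀ {n} → Fin n → Fin n → Bool
δ i j = does (i ≟ j)

mulOn : ∀ {n} → Subset n → Matrix n → Matrix n → Matrix n
mulOn U M N i j = ΣF U (λ k → M i k ∧ N k j)

IsInverseOn : ∀ {n} → Subset n → Matrix n → Matrix n → Set
IsInverseOn U M B =
  (∀ i j → mem U i ≡ true → mem U j ≡ true → mulOn U M B i j ≡ δ i j) ×
  (∀ i j → mem U i ≡ true → mem U j ≡ true → mulOn U B M i j ≡ δ i j)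

InvertibleOn : ∀ {n} → Subset n → Matrix n → Set
InvertibleOn U M = ∃ λ B → IsInverseOn U M B

Collection : ℕ → Set₁
Collection n = Subset n → Set

_⊕ˢ_ : ∀ {n} → Subset n → Subset n → Subset n
X ⊕ˢ Y = zipWith _xor_ X Y

_⊕ᶜ_ : ∀ {n} → Collection n → Subset n → Collection n
(𝒮 ⊕ᶜ X) Z = ∃ λ Y → 𝒮 Y × Z ≡ (Y ⊕ˢ X)

_≐_ : ∀ {n} → Collection n → Collection n → Set
ℛ ≐ 𝒮 = ∀ U → ℛ U ⇔ 𝒮 U

-- pivotal poset ℛ₀(G): all U with A_{U,U} invertible (U = ∅ included automatically)
ℛ₀ : ∀ {n} → Graph n → Collection n
ℛ₀ G U = InvertibleOn U (adj G)

Realizable : ∀ {n} → Collection n → Set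
Realizable {n} ℛ = ∃ λ (H : Graph n) → ℛ₀ H ≐ ℛ

-- Pivot A ∗ X, given P⁻¹ as B (only B on X×X is used):
--   X×X: P⁻¹ ;  X×Xᶜ: P⁻¹Q ;  Xᶜ×X: QᵀP⁻¹ ;  Xᶜ×Xᶜ: R − QᵀP⁻¹Q
pivot : ∀ {n} → Matrix n → Subset n → Matrix n → Matrix n
pivot A X B i j with mem X i | mem X j
... | true  | true  = B i j
... | true  | false = ΣF X (λ k → B i k ∧ A k j)
... | false | true  = ΣF X (λ k → A i k ∧ B k j)
... | false | false = A i j xor ΣF X (λ k → A i k ∧ ΣF X (λ l → B k l ∧ A l j))

module Submission where

-- Proof strategy.
--  * Invertibility of a principal submatrix A_{U,U} of a symmetric A is recast as
--    solvability of the "mixed" linear systems: for every c there is x with (Ax)_k = c_k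
--    for k ∈ U and x_k = c_k for k ∉ U (solve with the inverse; conversely the solutions
--    for the unit vectors form a right inverse, which is two-sided as A is symmetric).
--  * The pivot M = A ∗ W is the exchange of the W-coordinates of x and y = Ax: if y = Ax
--    then M maps (y on W, x off W) to (x on W, y off W), and vice versa.  Hence the mixed
--    system of A on U ⊕ W is solvable iff that of M on U is, i.e. ℛ₀(A ∗ W) = ℛ₀(G) ⊕ W.
--  * ∅ lies in every pivotal poset; so if H realizes ℛ₀(G) ⊕ W then ∅ = Y ⊕ W with
--    Y ∈ ℛ₀(G), forcing W = Y ∈ ℛ₀(G).
--  * A graph is determined by its pivotal poset (singletons detect loops, pairs detect
--    edges through the 2×2 determinant A_ii A_jj + A_ij), so H has adjacency matrix A ∗ W.

open import Defs
open import Data.Nat using (ℕ; zero; suc)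
open import Data.Bool using (Bool; true; false; _xor_; _∧_; _∨_; not; if_then_else_)
open import Data.Bool.Properties
  using (xor-identityʳ; xor-assoc; xor-comm; xor-same; ∧-distribˡ-xor; ∧-distribʳ-xor;
         ∧-comm; ∧-zeroʳ; ∨-zeroʳ; ∧-idem; xor-∧-commutativeRing; ∧-commutativeMonoid)
open import Algebra.Bundles using (CommutativeRing; CommutativeMonoid)
import Algebra.Properties.CommutativeSemigroup as CommSemigroupProperties
open import Data.Fin using (Fin; zero; suc; _≟_)
open import Data.Fin.Subset using (Subset) renaming (⊥ to ∅)
open import Data.Vec using ([]; _∷_; tabulate)
open import Data.Vec.Functional using (Vector)
open import Data.Vec.Properties using (lookup∘tabulate; tabulate∘lookup; tabulate-cong; lookup-zipWith; lookup-replicate)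
open import Data.Product using (∃; _×_; _,_; proj₁; proj₂)
open import Data.Sum using (_⊎_; inj₁; inj₂)
open import Data.Empty using (⊥; ⊥-elim)
open import Function using (_∘_)
open import Function.Bundles using (_⇔_; mk⇔; Equivalence)
open import Function.Properties.Equivalence using () renaming (sym to ⇔-sym; trans to ⇔-trans)
open import Relation.Nullary using (¬_; yes; no)
open import Relation.Binary.PropositionalEquality
open ≡-Reasoning

private
  variable
    n : ℕ

open CommSemigroupProperties (CommutativeRing.+-commutativeSemigroup xor-∧-commutativeRing)
  using () renaming (interchange to xor-interchange)
open CommSemigroupProperties (CommutativeMonoid.commutativeSemigroup ∧-commutativeMonoid)
  using () renaming (x∙yz≈y∙xz to ∧-swapˡ)

xor-cancelʳ : ∀ a t → (a xor t) xor t ≡ a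
xor-cancelʳ a t = trans (xor-assoc a t t) (trans (cong (a xor_) (xor-same t)) (xor-identityʳ a))

xor-cancelˡ : ∀ t a → t xor (t xor a) ≡ a
xor-cancelˡ t a = trans (sym (xor-assoc t t a)) (cong (_xor a) (xor-same t))

xor-cancel-both : ∀ a b t → (a xor t) xor (b xor t) ≡ a xor b
xor-cancel-both a b t = begin
  (a xor t) xor (b xor t)  ≡⟨ xor-interchange a t b t ⟩
  (a xor b) xor (t xor t)  ≡⟨ cong ((a xor b) xor_) (xor-same t) ⟩
  (a xor b) xor false      ≡⟨ xor-identityʳ (a xor b) ⟩
  a xor b                  ∎

xor-injectiveʳ : ∀ t {a b} → t xor a ≡ t xor b → a ≡ b
xor-injectiveʳ t {a} {b} e = trans (sym (xor-cancelˡ t a)) (trans (cong (t xor_) e) (xor-cancelˡ t b))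

⇔-true⇒≡ : ∀ {a b} → (a ≡ true ⇔ b ≡ true) → a ≡ b
⇔-true⇒≡ {true}          a⇔b = sym (Equivalence.to a⇔b refl)
⇔-true⇒≡ {false} {true}  a⇔b = Equivalence.from a⇔b refl
⇔-true⇒≡ {false} {false} a⇔b = refl

xor-false⇒≡ : ∀ {a b} → a xor b ≡ false → a ≡ b
xor-false⇒≡ {a} {b} e = trans (sym (xor-cancelʳ a b)) (cong (_xor b) e)

bool-cases : ∀ b → b ≡ true ⊎ b ≡ false
bool-cases true  = inj₁ refl
bool-cases false = inj₂ refl

true-∧ : ∀ {b} x → b ≡ true → b ∧ x ≡ x
true-∧ x refl = refl

∧-true⇒ˡ : ∀ {a b} → a ∧ b ≡ true → a ≡ true
∧-true⇒ˡ {true} _ = refl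

not-true⇒false : ∀ {b} → not b ≡ true → b ≡ false
not-true⇒false {false} _ = refl

if-true : ∀ {A : Set} {b} {x y : A} → b ≡ true → (if b then x else y) ≡ x
if-true refl = refl

if-false : ∀ {A : Set} {b} {x y : A} → b ≡ false → (if b then x else y) ≡ y
if-false refl = refl

δ-refl : (i : Fin n) → δ i i ≡ true
δ-refl zero    = refl
δ-refl (suc i) = δ-refl i

δ-sym : (i j : Fin n) → δ i j ≡ δ j i
δ-sym zero    zero    = refl
δ-sym zero    (suc j) = refl
δ-sym (suc i) zero    = refl
δ-sym (suc i) (suc j) = δ-sym i j

δ-true⇒≡ : (i j : Fin n) → δ i j ≡ true → i ≡ j
δ-true⇒≡ i j e with i ≟ j
... | yes i≡j = i≡j
δ-true⇒≡ i j () | no _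

δ-≢ : {i j : Fin n} → ¬ i ≡ j → δ i j ≡ false
δ-≢ {i = i} {j} i≢j with i ≟ j
... | yes i≡j = ⊥-elim (i≢j i≡j)
... | no _    = refl

∑ : Vector Bool n → Bool
∑ {zero}  f = false
∑ {suc n} f = f zero xor ∑ (f ∘ suc)

∑⟨_⟩_ : Vector Bool n → Vector Bool n → Bool
∑⟨ u ⟩ f = ∑ (λ k → u k ∧ f k)

∑-cong : {f g : Vector Bool n} → (∀ k → f k ≡ g k) → ∑ f ≡ ∑ g
∑-cong {zero}  e = refl
∑-cong {suc n} e = cong₂ _xor_ (e zero) (∑-cong (e ∘ suc))

∑-false : ∑ {n} (λ _ → false) ≡ false
∑-false {zero}  = refl
∑-false {suc n} = ∑-false {n}

∑-xor : (f g : Vector Bool n) → ∑ (λ k → f k xor g k) ≡ ∑ f xor ∑ g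
∑-xor {zero}  f g = refl
∑-xor {suc n} f g = trans (cong ((f zero xor g zero) xor_) (∑-xor (f ∘ suc) (g ∘ suc)))
                          (xor-interchange (f zero) (g zero) _ _)

∑-∧ˡ : ∀ a (f : Vector Bool n) → ∑ (λ k → a ∧ f k) ≡ a ∧ ∑ f
∑-∧ˡ {zero}  a f = sym (∧-zeroʳ a)
∑-∧ˡ {suc n} a f = trans (cong ((a ∧ f zero) xor_) (∑-∧ˡ a (f ∘ suc)))
                         (sym (∧-distribˡ-xor a (f zero) _))

∑-∧ʳ : ∀ a (f : Vector Bool n) → ∑ (λ k → f k ∧ a) ≡ ∑ f ∧ a
∑-∧ʳ a f = trans (∑-cong (λ k → ∧-comm (f k) a)) (trans (∑-∧ˡ a f) (∧-comm a (∑ f)))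

∑-swap : ∀ {m} (f : Fin n → Fin m → Bool) → ∑ (λ k → ∑ (f k)) ≡ ∑ (λ l → ∑ (λ k → f k l))
∑-swap {zero}  {m} f = sym (∑-false {m})
∑-swap {suc n}     f = trans (cong (∑ (f zero) xor_) (∑-swap (f ∘ suc)))
                             (sym (∑-xor (f zero) (λ l → ∑ (λ k → f (suc k) l))))

∑-δ : (i : Fin n) (f : Vector Bool n) → ∑ (λ k → δ i k ∧ f k) ≡ f i
∑-δ {suc n} zero    f = trans (cong (f zero xor_) (∑-false {n})) (xor-identityʳ (f zero))
∑-δ {suc n} (suc i) f = ∑-δ i (f ∘ suc)

∑⟨⟩-cong : (u : Vector Bool n) {f g : Vector Bool n} →
  (∀ k → u k ≡ true → f k ≡ g k) → ∑⟨ u ⟩ f ≡ ∑⟨ u ⟩ g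
∑⟨⟩-cong u {f} {g} e = ∑-cong (λ k → masked k (u k) refl)
  where
  masked : ∀ k b → u k ≡ b → u k ∧ f k ≡ u k ∧ g k
  masked k true  uk rewrite uk = e k uk
  masked k false uk rewrite uk = refl

∑⟨⟩-mask : {u v : Vector Bool n} (f : Vector Bool n) → (∀ k → u k ≡ v k) → ∑⟨ u ⟩ f ≡ ∑⟨ v ⟩ f
∑⟨⟩-mask f e = ∑-cong (λ k → cong (_∧ f k) (e k))

∑⟨⟩-distribˡ : ∀ (u F g h : Vector Bool n) →
  ∑⟨ u ⟩ (λ l → F l ∧ (g l xor h l)) ≡ ∑⟨ u ⟩ (λ l → F l ∧ g l) xor ∑⟨ u ⟩ (λ l → F l ∧ h l)
∑⟨⟩-distribˡ {n} u F g h = trans (∑-cong (λ l → trans (cong (u l ∧_) (∧-distribˡ-xor (F l) (g l) (h l)))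
                                                   (∧-distribˡ-xor (u l) _ _)))
                             (∑-xor {n} _ _)

∑⟨⟩-distribʳ : ∀ (u F G h : Vector Bool n) →
  ∑⟨ u ⟩ (λ l → (F l xor G l) ∧ h l) ≡ ∑⟨ u ⟩ (λ l → F l ∧ h l) xor ∑⟨ u ⟩ (λ l → G l ∧ h l)
∑⟨⟩-distribʳ {n} u F G h = trans (∑-cong (λ l → trans (cong (u l ∧_) (∧-distribʳ-xor (h l) (F l) (G l)))
                                                   (∧-distribˡ-xor (u l) _ _)))
                             (∑-xor {n} _ _)

∑⟨⟩-δ : ∀ u (i : Fin n) (f : Vector Bool n) → ∑⟨ u ⟩ (λ k → δ i k ∧ f k) ≡ u i ∧ f i
∑⟨⟩-δ {n} u i f = trans (∑-cong (λ k → ∧-swapˡ (u k) (δ i k) (f k))) (∑-δ {n} i _)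

∑⟨⟩-pick : ∀ u {i : Fin n} (f : Vector Bool n) → u i ≡ true → ∑⟨ u ⟩ (λ k → δ i k ∧ f k) ≡ f i
∑⟨⟩-pick u {i} f ui = trans (∑⟨⟩-δ u i f) (true-∧ (f i) ui)

∑⟨⟩-δʳ : ∀ u (i : Fin n) (f : Vector Bool n) → ∑⟨ u ⟩ (λ k → f k ∧ δ k i) ≡ u i ∧ f i
∑⟨⟩-δʳ u i f = trans (∑⟨⟩-cong u (λ k _ → trans (∧-comm (f k) (δ k i)) (cong (_∧ f k) (δ-sym k i))))
                     (∑⟨⟩-δ u i f)

∑⟨⟩-pickʳ : ∀ u {i : Fin n} (f : Vector Bool n) → u i ≡ true → ∑⟨ u ⟩ (λ k → f k ∧ δ k i) ≡ f i
∑⟨⟩-pickʳ u {i} f ui = trans (∑⟨⟩-δʳ u i f) (true-∧ (f i) ui)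

∑-split : (u f : Vector Bool n) → ∑ f ≡ ∑⟨ u ⟩ f xor ∑⟨ not ∘ u ⟩ f
∑-split {n} u f = trans (∑-cong (λ k → split (u k) (f k))) (∑-xor {n} _ _)
  where
  split : ∀ p a → a ≡ (p ∧ a) xor (not p ∧ a)
  split true  a = sym (xor-identityʳ a)
  split false a = refl

-- associativity of matrix multiplication, for products over two (possibly different) masks
∑⟨⟩-assoc : ∀ (p q F : Vector Bool n) (G : Matrix n) (H : Vector Bool n) →
  ∑⟨ p ⟩ (λ l → ∑⟨ q ⟩ (λ m → F m ∧ G m l) ∧ H l) ≡ ∑⟨ q ⟩ (λ m → F m ∧ ∑⟨ p ⟩ (λ l → G m l ∧ H l))
∑⟨⟩-assoc {n} p q F G H = begin
    ∑⟨ p ⟩ (λ l → ∑⟨ q ⟩ (λ m → F m ∧ G m l) ∧ H l)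
  ≡⟨ ∑-cong (λ l → trans (cong (p l ∧_) (sym (∑-∧ʳ {n} (H l) _))) (sym (∑-∧ˡ {n} (p l) _))) ⟩
    ∑ (λ l → ∑ (λ m → p l ∧ ((q m ∧ (F m ∧ G m l)) ∧ H l)))
  ≡⟨ ∑-swap {n} {n} _ ⟩
    ∑ (λ m → ∑ (λ l → p l ∧ ((q m ∧ (F m ∧ G m l)) ∧ H l)))
  ≡⟨ ∑-cong (λ m → ∑-cong (λ l → rearrange (p l) (q m) (F m) (G m l) (H l))) ⟩
    ∑ (λ m → ∑ (λ l → q m ∧ (F m ∧ (p l ∧ (G m l ∧ H l)))))
  ≡⟨ ∑-cong (λ m → trans (∑-∧ˡ {n} (q m) _) (cong (q m ∧_) (∑-∧ˡ {n} (F m) _))) ⟩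
    ∑⟨ q ⟩ (λ m → F m ∧ ∑⟨ p ⟩ (λ l → G m l ∧ H l))
  ∎
  where
  rearrange : ∀ p q a b c → p ∧ ((q ∧ (a ∧ b)) ∧ c) ≡ q ∧ (a ∧ (p ∧ (b ∧ c)))
  rearrange true  true  true  b c = refl
  rearrange true  true  false b c = refl
  rearrange true  false a     b c = refl
  rearrange false true  true  b c = refl
  rearrange false true  false b c = refl
  rearrange false false a     b c = refl

ΣF≡∑⟨mem⟩ : (U : Subset n) (f : Vector Bool n) → ΣF U f ≡ ∑⟨ mem U ⟩ f
ΣF≡∑⟨mem⟩ {zero}  []      f = refl
ΣF≡∑⟨mem⟩ {suc n} (b ∷ U) f = cong ((b ∧ f zero) xor_) (ΣF≡∑⟨mem⟩ U (f ∘ suc))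

Symmetric : Matrix n → Set
Symmetric A = ∀ i j → A i j ≡ A j i

RightInverseOn : Vector Bool n → Matrix n → Matrix n → Set
RightInverseOn u A B = ∀ i j → u i ≡ true → u j ≡ true → ∑⟨ u ⟩ (λ k → A i k ∧ B k j) ≡ δ i j

-- a right inverse of a symmetric matrix is symmetric: since BᵀA = (AB)ᵀ = I,
-- B = (BᵀA) B = Bᵀ (AB) = Bᵀ
rightInverse-symmetric : ∀ u (A B : Matrix n) → Symmetric A → RightInverseOn u A B →
  ∀ i j → u i ≡ true → u j ≡ true → B i j ≡ B j i
rightInverse-symmetric u A B symA AB=I i j ui uj = begin
    B i j
  ≡⟨ sym (∑⟨⟩-pick u (λ l → B l j) ui) ⟩
    ∑⟨ u ⟩ (λ l → δ i l ∧ B l j)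
  ≡⟨ ∑⟨⟩-cong u (λ l ul → cong (_∧ B l j) (δ-as-product l ul)) ⟩
    ∑⟨ u ⟩ (λ l → ∑⟨ u ⟩ (λ k → B k i ∧ A k l) ∧ B l j)
  ≡⟨ ∑⟨⟩-assoc u u (λ k → B k i) A (λ l → B l j) ⟩
    ∑⟨ u ⟩ (λ k → B k i ∧ ∑⟨ u ⟩ (λ l → A k l ∧ B l j))
  ≡⟨ ∑⟨⟩-cong u (λ k uk → cong (B k i ∧_) (AB=I k j uk uj)) ⟩
    ∑⟨ u ⟩ (λ k → B k i ∧ δ k j)
  ≡⟨ ∑⟨⟩-pickʳ u (λ k → B k i) uj ⟩
    B j i
  ∎
  where
  δ-as-product : ∀ l → u l ≡ true → δ i l ≡ ∑⟨ u ⟩ (λ k → B k i ∧ A k l)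
  δ-as-product l ul = trans (δ-sym i l) (trans (sym (AB=I l i ul ui))
    (∑⟨⟩-cong u (λ k _ → trans (∧-comm (A l k) (B k i)) (cong (B k i ∧_) (symA l k)))))

rightInverse⇒inverse : ∀ (U : Subset n) (A B : Matrix n) → Symmetric A →
  RightInverseOn (mem U) A B → IsInverseOn U A B
rightInverse⇒inverse U A B symA AB=I =
  (λ i j ui uj → trans (ΣF≡∑⟨mem⟩ U _) (AB=I i j ui uj)) ,
  (λ i j ui uj → trans (ΣF≡∑⟨mem⟩ U _) (trans
     (∑⟨⟩-cong (mem U) (λ k uk → trans (∧-comm (B i k) (A k j))
        (cong₂ _∧_ (symA k j) (rightInverse-symmetric (mem U) A B symA AB=I i k ui uk))))
     (trans (AB=I j i uj ui) (δ-sym j i))))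

inverse⇒rightInverse : ∀ (U : Subset n) (A B : Matrix n) → IsInverseOn U A B → RightInverseOn (mem U) A B
inverse⇒rightInverse U A B (AB=I , _) i j ui uj = trans (sym (ΣF≡∑⟨mem⟩ U _)) (AB=I i j ui uj)

inverse⇒leftInverse : ∀ (U : Subset n) (A B : Matrix n) → IsInverseOn U A B → RightInverseOn (mem U) B A
inverse⇒leftInverse U A B (_ , BA=I) i j ui uj = trans (sym (ΣF≡∑⟨mem⟩ U _)) (BA=I i j ui uj)

-- Mixed linear systems.  Invertibility of A_{u,u} is recast as solvability of the system
-- "(A x)_k = c_k for k ∈ u, x_k = c_k for k ∉ u", which is what the pivot transforms well.

_·_ : Matrix n → Vector Bool n → Vector Bool n
(A · x) k = ∑ (λ l → A k l ∧ x l)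

select : Vector Bool n → Vector Bool n → Vector Bool n → Vector Bool n
select u y x k = if u k then y k else x k

MixedSolvable : Matrix n → Vector Bool n → Set
MixedSolvable {n} A u = ∀ (c : Vector Bool n) → ∃ λ x → ∀ k → select u (A · x) x k ≡ c k

select-mask : ∀ {u v : Vector Bool n} y x → (∀ k → u k ≡ v k) → ∀ k → select u y x k ≡ select v y x k
select-mask y x e k = cong (λ b → if b then y k else x k) (e k)

solvable-mask : ∀ (A : Matrix n) {u v} → (∀ k → u k ≡ v k) → MixedSolvable A u → MixedSolvable A v
solvable-mask A e solve c with solve c
... | x , solves = x , λ k → trans (sym (select-mask (A · x) x e k)) (solves k)

-- with a right inverse B, solve on u by x = B (c − (contribution of the coordinates outside u))
rightInverse⇒solvable : ∀ u (A B : Matrix n) → RightInverseOn u A B → MixedSolvable A u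
rightInverse⇒solvable {n} u A B AB=I c = x , solves
  where
  outside : Vector Bool n
  outside m = ∑⟨ not ∘ u ⟩ (λ p → A m p ∧ c p)
  d : Vector Bool n
  d m = c m xor outside m
  x : Vector Bool n
  x l = if u l then ∑⟨ u ⟩ (λ m → B l m ∧ d m) else c l
  inside-part : ∀ k → u k ≡ true → ∑⟨ u ⟩ (λ l → A k l ∧ x l) ≡ d k
  inside-part k uk = begin
      ∑⟨ u ⟩ (λ l → A k l ∧ x l)
    ≡⟨ ∑⟨⟩-cong u (λ l ul → cong (A k l ∧_) (if-true ul)) ⟩
      ∑⟨ u ⟩ (λ l → A k l ∧ ∑⟨ u ⟩ (λ m → B l m ∧ d m))
    ≡⟨ sym (∑⟨⟩-assoc u u (A k) B d) ⟩
      ∑⟨ u ⟩ (λ m → ∑⟨ u ⟩ (λ l → A k l ∧ B l m) ∧ d m)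
    ≡⟨ ∑⟨⟩-cong u (λ m um → cong (_∧ d m) (AB=I k m uk um)) ⟩
      ∑⟨ u ⟩ (λ m → δ k m ∧ d m)
    ≡⟨ ∑⟨⟩-pick u d uk ⟩
      d k
    ∎
  outside-part : ∀ k → ∑⟨ not ∘ u ⟩ (λ l → A k l ∧ x l) ≡ outside k
  outside-part k = ∑⟨⟩-cong (not ∘ u) (λ l ul̸ → cong (A k l ∧_) (if-false (not-true⇒false ul̸)))
  solves : ∀ k → select u (A · x) x k ≡ c k
  solves k with bool-cases (u k)
  ... | inj₁ uk = begin
      select u (A · x) x k                                        ≡⟨ if-true uk ⟩
      (A · x) k                                                   ≡⟨ ∑-split u _ ⟩
      ∑⟨ u ⟩ (λ l → A k l ∧ x l) xor ∑⟨ not ∘ u ⟩ (λ l → A k l ∧ x l) ≡⟨ cong₂ _xor_ (inside-part k uk) (outside-part k) ⟩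
      d k xor outside k                                           ≡⟨ xor-cancelʳ (c k) (outside k) ⟩
      c k                                                         ∎
  ... | inj₂ uk = trans (if-false uk) (if-false uk)

-- conversely, the solutions for the unit vectors c = e_j are the columns of a right inverse
solvable⇒rightInverse : ∀ u (A : Matrix n) → MixedSolvable A u → ∃ λ B → RightInverseOn u A B
solvable⇒rightInverse {n} u A solve = B , AB=I
  where
  column : Fin n → Vector Bool n
  column j = proj₁ (solve (λ m → δ m j))
  B : Matrix n
  B k j = column j k
  AB=I : RightInverseOn u A B
  AB=I i j ui uj = begin
      ∑⟨ u ⟩ (λ k → A i k ∧ B k j)
    ≡⟨ sym (xor-identityʳ _) ⟩
      ∑⟨ u ⟩ (λ k → A i k ∧ B k j) xor false
    ≡⟨ cong (∑⟨ u ⟩ (λ k → A i k ∧ B k j) xor_) (sym outside-vanishes) ⟩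
      ∑⟨ u ⟩ (λ k → A i k ∧ B k j) xor ∑⟨ not ∘ u ⟩ (λ k → A i k ∧ B k j)
    ≡⟨ sym (∑-split u _) ⟩
      (A · column j) i
    ≡⟨ trans (sym (if-true ui)) (proj₂ (solve (λ m → δ m j)) i) ⟩
      δ i j
    ∎
    where
    -- off u, column j agrees with e_j, which vanishes there since j ∈ u
    outside-vanishes : ∑⟨ not ∘ u ⟩ (λ k → A i k ∧ B k j) ≡ false
    outside-vanishes = trans
      (∑⟨⟩-cong (not ∘ u) (λ k uk̸ → cong (A i k ∧_) (trans (sym (if-false (not-true⇒false uk̸)))
                                                           (proj₂ (solve (λ m → δ m j)) k))))
      (trans (∑⟨⟩-δʳ (not ∘ u) j (A i)) (cong (λ b → not b ∧ A i j) uj))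

invertible⇒solvable : ∀ (U : Subset n) (A : Matrix n) → InvertibleOn U A → MixedSolvable A (mem U)
invertible⇒solvable U A (B , inv) = rightInverse⇒solvable (mem U) A B (inverse⇒rightInverse U A B inv)

solvable⇒invertible : ∀ (U : Subset n) (A : Matrix n) → Symmetric A → MixedSolvable A (mem U) → InvertibleOn U A
solvable⇒invertible U A symA solve with solvable⇒rightInverse (mem U) A solve
... | B , AB=I = B , rightInverse⇒inverse U A B symA AB=I

subset-ext : {U V : Subset n} → (∀ k → mem U k ≡ mem V k) → U ≡ V
subset-ext {U = U} {V} e = trans (sym (tabulate∘lookup U)) (trans (tabulate-cong e) (tabulate∘lookup V))

mem-⊕ˢ : (U W : Subset n) (k : Fin n) → mem (U ⊕ˢ W) k ≡ mem U k xor mem W k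
mem-⊕ˢ U W k = lookup-zipWith _xor_ k U W

⊕ˢ-cancelʳ : (U W : Subset n) → (U ⊕ˢ W) ⊕ˢ W ≡ U
⊕ˢ-cancelʳ U W = subset-ext (λ k → trans (mem-⊕ˢ (U ⊕ˢ W) W k)
                              (trans (cong (_xor mem W k) (mem-⊕ˢ U W k)) (xor-cancelʳ (mem U k) (mem W k))))

-- Selecting by u between (a or b, chosen by w) and (b or a, chosen by w) is selecting
-- by u xor w between b and a: the bookkeeping behind the coordinate exchange.
select-exchange : ∀ u w (a b : Bool) →
  (if u then (if w then a else b) else (if w then b else a)) ≡ (if u xor w then b else a)
select-exchange true  true  a b = refl
select-exchange true  false a b = refl
select-exchange false true  a b = refl
select-exchange false false a b = refl

module Pivot {n} (G : Graph n) (W : Subset n) (B : Matrix n) (inv : IsInverseOn W (adj G) B) where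
  A : Matrix n
  A = adj G

  w : Vector Bool n
  w = mem W

  M : Matrix n
  M = pivot A W B

  AB=I : RightInverseOn w A B
  AB=I = inverse⇒rightInverse W A B inv

  BA=I : RightInverseOn w B A
  BA=I = inverse⇒leftInverse W A B inv

  symB : ∀ i j → w i ≡ true → w j ≡ true → B i j ≡ B j i
  symB = rightInverse-symmetric w A B (symm G) AB=I

  -- the correction term Qᵀ P⁻¹ Q of the block outside W
  schur : Matrix n
  schur i j = ∑⟨ w ⟩ (λ k → A i k ∧ ∑⟨ w ⟩ (λ l → B k l ∧ A l j))

  M-in-in : ∀ {i j} → w i ≡ true → w j ≡ true → M i j ≡ B i j
  M-in-in {i} {j} wi wj rewrite wi | wj = refl

  M-in-out : ∀ {i j} → w i ≡ true → w j ≡ false → M i j ≡ ∑⟨ w ⟩ (λ k → B i k ∧ A k j)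
  M-in-out {i} {j} wi wj rewrite wi | wj = ΣF≡∑⟨mem⟩ W _

  M-out-in : ∀ {i j} → w i ≡ false → w j ≡ true → M i j ≡ ∑⟨ w ⟩ (λ k → A i k ∧ B k j)
  M-out-in {i} {j} wi wj rewrite wi | wj = ΣF≡∑⟨mem⟩ W _

  M-out-out : ∀ {i j} → w i ≡ false → w j ≡ false → M i j ≡ A i j xor schur i j
  M-out-out {i} {j} wi wj rewrite wi | wj =
    cong (A i j xor_) (trans (ΣF≡∑⟨mem⟩ W _) (∑⟨⟩-cong w (λ k _ → cong (A i k ∧_) (ΣF≡∑⟨mem⟩ W _))))

  schur-symmetric : ∀ i j → schur j i ≡ schur i j
  schur-symmetric i j = begin
      ∑⟨ w ⟩ (λ k → A j k ∧ ∑⟨ w ⟩ (λ l → B k l ∧ A l i))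
    ≡⟨ sym (∑⟨⟩-assoc w w (A j) B (λ l → A l i)) ⟩
      ∑⟨ w ⟩ (λ l → ∑⟨ w ⟩ (λ k → A j k ∧ B k l) ∧ A l i)
    ≡⟨ ∑⟨⟩-cong w (λ l wl → trans (∧-comm _ (A l i)) (cong₂ _∧_ (symm G l i)
         (∑⟨⟩-cong w (λ k wk → trans (∧-comm (A j k) (B k l)) (cong₂ _∧_ (symB k l wk wl) (symm G j k)))))) ⟩
      ∑⟨ w ⟩ (λ l → A i l ∧ ∑⟨ w ⟩ (λ k → B l k ∧ A k j))
    ∎

  schur-as-ABA : ∀ k p → ∑⟨ w ⟩ (λ l → ∑⟨ w ⟩ (λ m → A k m ∧ B m l) ∧ A l p) ≡ schur k p
  schur-as-ABA k p = ∑⟨⟩-assoc w w (A k) B (λ l → A l p)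

  -- on the column block W the correction is A itself, since B A = I there
  schur-on-W : ∀ k p → w p ≡ true → schur k p ≡ A k p
  schur-on-W k p wp = trans (∑⟨⟩-cong w (λ m wm → cong (A k m ∧_) (BA=I m p wm wp))) (∑⟨⟩-pickʳ w (A k) wp)

  M-in-out-symmetric : ∀ i j → w i ≡ true → w j ≡ false → M i j ≡ M j i
  M-in-out-symmetric i j wi wj = trans (M-in-out wi wj) (trans
    (∑⟨⟩-cong w (λ k wk → trans (∧-comm (B i k) (A k j)) (cong₂ _∧_ (symm G k j) (symB i k wi wk))))
    (sym (M-out-in wj wi)))

  pivot-symmetric : Symmetric M
  pivot-symmetric i j with bool-cases (w i) | bool-cases (w j)
  ... | inj₁ wi | inj₁ wj = trans (M-in-in wi wj) (trans (symB i j wi wj) (sym (M-in-in wj wi)))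
  ... | inj₁ wi | inj₂ wj = M-in-out-symmetric i j wi wj
  ... | inj₂ wi | inj₁ wj = sym (M-in-out-symmetric j i wj wi)
  ... | inj₂ wi | inj₂ wj = trans (M-out-out wi wj)
        (trans (cong₂ _xor_ (symm G i j) (sym (schur-symmetric i j))) (sym (M-out-out wj wi)))

  pivotGraph : Graph n
  pivotGraph = graph M pivot-symmetric

  w̄ : Vector Bool n
  w̄ = not ∘ w

  forward-in : ∀ x k → w k ≡ true → (M · select w (A · x) x) k ≡ x k
  forward-in x k wk = begin
      (M · x') k
    ≡⟨ ∑-split w _ ⟩
      ∑⟨ w ⟩ (λ l → M k l ∧ x' l) xor ∑⟨ w̄ ⟩ (λ l → M k l ∧ x' l)
    ≡⟨ cong₂ _xor_ inside outside ⟩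
      (x k xor T) xor T
    ≡⟨ xor-cancelʳ (x k) T ⟩
      x k
    ∎
    where
    x' : Vector Bool n
    x' = select w (A · x) x
    T : Bool
    T = ∑⟨ w̄ ⟩ (λ m → ∑⟨ w ⟩ (λ l → B k l ∧ A l m) ∧ x m)
    inside : ∑⟨ w ⟩ (λ l → M k l ∧ x' l) ≡ x k xor T
    inside = begin
        ∑⟨ w ⟩ (λ l → M k l ∧ x' l)
      ≡⟨ ∑⟨⟩-cong w (λ l wl → cong₂ _∧_ (M-in-in wk wl) (trans (if-true wl) (∑-split w _))) ⟩
        ∑⟨ w ⟩ (λ l → B k l ∧ (∑⟨ w ⟩ (λ m → A l m ∧ x m) xor ∑⟨ w̄ ⟩ (λ m → A l m ∧ x m)))
      ≡⟨ ∑⟨⟩-distribˡ w (B k) _ _ ⟩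
        ∑⟨ w ⟩ (λ l → B k l ∧ ∑⟨ w ⟩ (λ m → A l m ∧ x m)) xor ∑⟨ w ⟩ (λ l → B k l ∧ ∑⟨ w̄ ⟩ (λ m → A l m ∧ x m))
      ≡⟨ cong₂ _xor_ (sym (∑⟨⟩-assoc w w (B k) A x)) (sym (∑⟨⟩-assoc w̄ w (B k) A x)) ⟩
        ∑⟨ w ⟩ (λ m → ∑⟨ w ⟩ (λ l → B k l ∧ A l m) ∧ x m) xor T
      ≡⟨ cong (_xor T) (trans (∑⟨⟩-cong w (λ m wm → cong (_∧ x m) (BA=I k m wk wm))) (∑⟨⟩-pick w x wk)) ⟩
        x k xor T
      ∎
    outside : ∑⟨ w̄ ⟩ (λ l → M k l ∧ x' l) ≡ T
    outside = ∑⟨⟩-cong w̄ (λ l w̄l → cong₂ _∧_ (M-in-out wk (not-true⇒false w̄l)) (if-false (not-true⇒false w̄l)))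

  forward-out : ∀ x k → w k ≡ false → (M · select w (A · x) x) k ≡ (A · x) k
  forward-out x k wk = begin
      (M · x') k
    ≡⟨ ∑-split w _ ⟩
      ∑⟨ w ⟩ (λ l → M k l ∧ x' l) xor ∑⟨ w̄ ⟩ (λ l → M k l ∧ x' l)
    ≡⟨ cong₂ _xor_ inside outside ⟩
      (P xor T) xor (N xor T)
    ≡⟨ xor-cancel-both P N T ⟩
      P xor N
    ≡⟨ sym (∑-split w _) ⟩
      (A · x) k
    ∎
    where
    x' : Vector Bool n
    x' = select w (A · x) x
    AB : Vector Bool n
    AB l = ∑⟨ w ⟩ (λ m → A k m ∧ B m l)
    P N T : Bool
    P = ∑⟨ w ⟩ (λ p → A k p ∧ x p)
    N = ∑⟨ w̄ ⟩ (λ p → A k p ∧ x p)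
    T = ∑⟨ w̄ ⟩ (λ p → schur k p ∧ x p)
    inside : ∑⟨ w ⟩ (λ l → M k l ∧ x' l) ≡ P xor T
    inside = begin
        ∑⟨ w ⟩ (λ l → M k l ∧ x' l)
      ≡⟨ ∑⟨⟩-cong w (λ l wl → cong₂ _∧_ (M-out-in wk wl) (trans (if-true wl) (∑-split w _))) ⟩
        ∑⟨ w ⟩ (λ l → AB l ∧ (∑⟨ w ⟩ (λ m → A l m ∧ x m) xor ∑⟨ w̄ ⟩ (λ m → A l m ∧ x m)))
      ≡⟨ ∑⟨⟩-distribˡ w AB _ _ ⟩
        ∑⟨ w ⟩ (λ l → AB l ∧ ∑⟨ w ⟩ (λ m → A l m ∧ x m)) xor ∑⟨ w ⟩ (λ l → AB l ∧ ∑⟨ w̄ ⟩ (λ m → A l m ∧ x m))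
      ≡⟨ cong₂ _xor_ (sym (∑⟨⟩-assoc w w AB A x)) (sym (∑⟨⟩-assoc w̄ w AB A x)) ⟩
        ∑⟨ w ⟩ (λ p → ∑⟨ w ⟩ (λ l → AB l ∧ A l p) ∧ x p) xor ∑⟨ w̄ ⟩ (λ p → ∑⟨ w ⟩ (λ l → AB l ∧ A l p) ∧ x p)
      ≡⟨ cong₂ _xor_ (∑⟨⟩-cong w (λ p wp → cong (_∧ x p) (trans (schur-as-ABA k p) (schur-on-W k p wp))))
                     (∑⟨⟩-cong w̄ (λ p _ → cong (_∧ x p) (schur-as-ABA k p))) ⟩
        P xor T
      ∎
    outside : ∑⟨ w̄ ⟩ (λ l → M k l ∧ x' l) ≡ N xor T
    outside = trans (∑⟨⟩-cong w̄ (λ l w̄l → cong₂ _∧_ (M-out-out wk (not-true⇒false w̄l)) (if-false (not-true⇒false w̄l))))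
                    (∑⟨⟩-distribʳ w̄ (A k) (schur k) x)

  exchange-forward : ∀ x k → (M · select w (A · x) x) k ≡ select w x (A · x) k
  exchange-forward x k with bool-cases (w k)
  ... | inj₁ wk = trans (forward-in x k wk) (sym (if-true wk))
  ... | inj₂ wk = trans (forward-out x k wk) (sym (if-false wk))

  module _ (x' : Vector Bool n) (k : Fin n) where
    private
      x : Vector Bool n
      x = select w (M · x') x'
      BA : Matrix n
      BA l m = ∑⟨ w ⟩ (λ p → B l p ∧ A p m)
      U₁ U₂ N : Bool
      U₁ = ∑⟨ w ⟩ (λ m → ∑⟨ w ⟩ (λ l → A k l ∧ B l m) ∧ x' m)
      U₂ = ∑⟨ w̄ ⟩ (λ m → schur k m ∧ x' m)
      N  = ∑⟨ w̄ ⟩ (λ l → A k l ∧ x' l)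

      backward-expand : (A · x) k ≡ (U₁ xor U₂) xor N
      backward-expand = begin
          (A · x) k
        ≡⟨ ∑-split w _ ⟩
          ∑⟨ w ⟩ (λ l → A k l ∧ x l) xor ∑⟨ w̄ ⟩ (λ l → A k l ∧ x l)
        ≡⟨ cong₂ _xor_ inside (∑⟨⟩-cong w̄ (λ l w̄l → cong (A k l ∧_) (if-false (not-true⇒false w̄l)))) ⟩
          (U₁ xor U₂) xor N
        ∎
        where
        inside : ∑⟨ w ⟩ (λ l → A k l ∧ x l) ≡ U₁ xor U₂
        inside = begin
            ∑⟨ w ⟩ (λ l → A k l ∧ x l)
          ≡⟨ ∑⟨⟩-cong w (λ l wl → cong (A k l ∧_) (trans (if-true wl) (trans (∑-split w _)
               (cong₂ _xor_ (∑⟨⟩-cong w (λ m wm → cong (_∧ x' m) (M-in-in wl wm)))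
                            (∑⟨⟩-cong w̄ (λ m w̄m → cong (_∧ x' m) (M-in-out wl (not-true⇒false w̄m)))))))) ⟩
            ∑⟨ w ⟩ (λ l → A k l ∧ (∑⟨ w ⟩ (λ m → B l m ∧ x' m) xor ∑⟨ w̄ ⟩ (λ m → BA l m ∧ x' m)))
          ≡⟨ ∑⟨⟩-distribˡ w (A k) _ _ ⟩
            ∑⟨ w ⟩ (λ l → A k l ∧ ∑⟨ w ⟩ (λ m → B l m ∧ x' m)) xor ∑⟨ w ⟩ (λ l → A k l ∧ ∑⟨ w̄ ⟩ (λ m → BA l m ∧ x' m))
          ≡⟨ cong₂ _xor_ (sym (∑⟨⟩-assoc w w (A k) B x')) (sym (∑⟨⟩-assoc w̄ w (A k) BA x')) ⟩
            U₁ xor U₂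
          ∎

    backward-in : w k ≡ true → (A · x) k ≡ x' k
    backward-in wk = begin
        (A · x) k             ≡⟨ backward-expand ⟩
        (U₁ xor U₂) xor N     ≡⟨ cong₂ (λ a b → (a xor b) xor N) U₁≡x' U₂≡N ⟩
        (x' k xor N) xor N    ≡⟨ xor-cancelʳ (x' k) N ⟩
        x' k                  ∎
      where
      U₁≡x' : U₁ ≡ x' k
      U₁≡x' = trans (∑⟨⟩-cong w (λ m wm → cong (_∧ x' m) (AB=I k m wk wm))) (∑⟨⟩-pick w x' wk)
      -- on the row block W the correction is A itself (transpose of schur-on-W)
      U₂≡N : U₂ ≡ N
      U₂≡N = ∑⟨⟩-cong w̄ (λ m _ → cong (_∧ x' m)
               (trans (schur-symmetric m k) (trans (schur-on-W m k wk) (symm G m k))))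

    backward-out : w k ≡ false → (A · x) k ≡ (M · x') k
    backward-out wk = begin
        (A · x) k
      ≡⟨ backward-expand ⟩
        (U₁ xor U₂) xor N
      ≡⟨ xor-assoc U₁ U₂ N ⟩
        U₁ xor (U₂ xor N)
      ≡⟨ cong (U₁ xor_) (xor-comm U₂ N) ⟩
        U₁ xor (N xor U₂)
      ≡⟨ sym (cong₂ _xor_ (∑⟨⟩-cong w (λ m wm → cong (_∧ x' m) (M-out-in wk wm)))
           (trans (∑⟨⟩-cong w̄ (λ m w̄m → cong (_∧ x' m) (M-out-out wk (not-true⇒false w̄m))))
                  (∑⟨⟩-distribʳ w̄ (A k) (schur k) x'))) ⟩
        ∑⟨ w ⟩ (λ m → M k m ∧ x' m) xor ∑⟨ w̄ ⟩ (λ m → M k m ∧ x' m)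
      ≡⟨ sym (∑-split w _) ⟩
        (M · x') k
      ∎

  exchange-backward : ∀ x' k → (A · select w (M · x') x') k ≡ select w x' (M · x') k
  exchange-backward x' k with bool-cases (w k)
  ... | inj₁ wk = trans (backward-in x' k wk) (sym (if-true wk))
  ... | inj₂ wk = trans (backward-out x' k wk) (sym (if-false wk))

  solvable-A⇒M : ∀ u → MixedSolvable A (λ k → u k xor w k) → MixedSolvable M u
  solvable-A⇒M u solve c with solve c
  ... | x , solves = select w (A · x) x , λ k → begin
      select u (M · select w (A · x) x) (select w (A · x) x) k
    ≡⟨ cong (λ t → if u k then t else select w (A · x) x k) (exchange-forward x k) ⟩
      (if u k then select w x (A · x) k else select w (A · x) x k)
    ≡⟨ select-exchange (u k) (w k) (x k) ((A · x) k) ⟩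
      select (λ k → u k xor w k) (A · x) x k
    ≡⟨ solves k ⟩
      c k
    ∎

  solvable-M⇒A : ∀ u → MixedSolvable M u → MixedSolvable A (λ k → u k xor w k)
  solvable-M⇒A u solve c with solve c
  ... | x' , solves = select w (M · x') x' , λ k → begin
      select (λ k → u k xor w k) (A · select w (M · x') x') (select w (M · x') x') k
    ≡⟨ cong (λ t → if u k xor w k then t else select w (M · x') x' k) (exchange-backward x' k) ⟩
      (if u k xor w k then select w x' (M · x') k else select w (M · x') x' k)
    ≡⟨ select-exchange (u k xor w k) (w k) (x' k) ((M · x') k) ⟩
      (if (u k xor w k) xor w k then (M · x') k else x' k)
    ≡⟨ cong (λ b → if b then (M · x') k else x' k) (xor-cancelʳ (u k) (w k)) ⟩
      select u (M · x') x' k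
    ≡⟨ solves k ⟩
      c k
    ∎

  pivotal-in-pivot : ∀ U → ℛ₀ pivotGraph U ⇔ ℛ₀ G (U ⊕ˢ W)
  pivotal-in-pivot U = mk⇔
    (λ invM → solvable⇒invertible (U ⊕ˢ W) A (symm G)
       (solvable-mask A (λ k → sym (mem-⊕ˢ U W k)) (solvable-M⇒A (mem U) (invertible⇒solvable U M invM))))
    (λ invA → solvable⇒invertible U M pivot-symmetric
       (solvable-A⇒M (mem U) (solvable-mask A (mem-⊕ˢ U W) (invertible⇒solvable (U ⊕ˢ W) A invA))))

  pivot-realizes : ℛ₀ pivotGraph ≐ (ℛ₀ G ⊕ᶜ W)
  pivot-realizes U = mk⇔
    (λ invM → U ⊕ˢ W , Equivalence.to (pivotal-in-pivot U) invM , sym (⊕ˢ-cancelʳ U W))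
    (λ { (Y , invY , refl) → Equivalence.from (pivotal-in-pivot (Y ⊕ˢ W))
                               (subst (ℛ₀ G) (sym (⊕ˢ-cancelʳ Y W)) invY) })

-- A graph is determined by its pivotal poset: loops are detected by singletons {i}, and
-- edges by pairs {i, j}, whose 2×2 principal submatrix has determinant A_ii A_jj + A_ij.

singleton : Fin n → Subset n
singleton i = tabulate (δ i)

mem-singleton : (i k : Fin n) → mem (singleton i) k ≡ δ i k
mem-singleton i = lookup∘tabulate (δ i)

ΣF-singleton : (i : Fin n) (f : Vector Bool n) → ΣF (singleton i) f ≡ f i
ΣF-singleton i f = trans (ΣF≡∑⟨mem⟩ (singleton i) f) (trans (∑⟨⟩-mask f (mem-singleton i)) (∑-δ i f))

∈-singleton : (i k : Fin n) → mem (singleton i) k ≡ true → i ≡ k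
∈-singleton i k e = δ-true⇒≡ i k (trans (sym (mem-singleton i k)) e)

loop⇔pivotal : (A : Matrix n) (i : Fin n) → A i i ≡ true ⇔ InvertibleOn (singleton i) A
loop⇔pivotal A i = mk⇔ looped⇒invertible invertible⇒looped
  where
  i∈ : mem (singleton i) i ≡ true
  i∈ = trans (mem-singleton i i) (δ-refl i)
  invertible⇒looped : InvertibleOn (singleton i) A → A i i ≡ true
  invertible⇒looped (B , AB=I , _) = ∧-true⇒ˡ (trans (sym (ΣF-singleton i _)) (trans (AB=I i i i∈ i∈) (δ-refl i)))
  looped⇒invertible : A i i ≡ true → InvertibleOn (singleton i) A
  looped⇒invertible aii = (λ _ _ → true) , AB=I , BA=I
    where
    AB=I : ∀ p q → mem (singleton i) p ≡ true → mem (singleton i) q ≡ true →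
      mulOn (singleton i) A (λ _ _ → true) p q ≡ δ p q
    AB=I p q p∈ q∈ with ∈-singleton i p p∈ | ∈-singleton i q q∈
    ... | refl | refl = trans (ΣF-singleton i _) (trans (cong (_∧ true) aii) (sym (δ-refl i)))
    BA=I : ∀ p q → mem (singleton i) p ≡ true → mem (singleton i) q ≡ true →
      mulOn (singleton i) (λ _ _ → true) A p q ≡ δ p q
    BA=I p q p∈ q∈ with ∈-singleton i p p∈ | ∈-singleton i q q∈
    ... | refl | refl = trans (ΣF-singleton i _) (trans aii (sym (δ-refl i)))

pair : Fin n → Fin n → Subset n
pair i j = tabulate (λ k → δ i k ∨ δ j k)

mem-pair : (i j k : Fin n) → mem (pair i j) k ≡ δ i k ∨ δ j k
mem-pair i j = lookup∘tabulate (λ k → δ i k ∨ δ j k)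

left∈pair : (i j : Fin n) → mem (pair i j) i ≡ true
left∈pair i j = trans (mem-pair i j i) (cong (_∨ δ j i) (δ-refl i))

right∈pair : (i j : Fin n) → mem (pair i j) j ≡ true
right∈pair i j = trans (mem-pair i j j) (trans (cong (δ i j ∨_) (δ-refl j)) (∨-zeroʳ (δ i j)))

∈-pair : (i j p : Fin n) → mem (pair i j) p ≡ true → i ≡ p ⊎ j ≡ p
∈-pair i j p p∈ with bool-cases (δ i p)
... | inj₁ δip = inj₁ (δ-true⇒≡ i p δip)
... | inj₂ δip = inj₂ (δ-true⇒≡ j p (trans (sym (cong (_∨ δ j p) δip)) (trans (sym (mem-pair i j p)) p∈)))

ΣF-pair : {i j : Fin n} → ¬ i ≡ j → (f : Vector Bool n) → ΣF (pair i j) f ≡ f i xor f j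
ΣF-pair {n} {i} {j} i≢j f = begin
    ΣF (pair i j) f
  ≡⟨ ΣF≡∑⟨mem⟩ (pair i j) f ⟩
    ∑⟨ mem (pair i j) ⟩ f
  ≡⟨ ∑-cong (λ k → trans (cong (_∧ f k) (mem-pair i j k))
       (disjoint-∨ (δ i k) (δ j k) (f k) (λ δik δjk → i≢j (trans (δ-true⇒≡ i k δik) (sym (δ-true⇒≡ j k δjk)))))) ⟩
    ∑ (λ k → (δ i k ∧ f k) xor (δ j k ∧ f k))
  ≡⟨ ∑-xor {n} _ _ ⟩
    ∑ (λ k → δ i k ∧ f k) xor ∑ (λ k → δ j k ∧ f k)
  ≡⟨ cong₂ _xor_ (∑-δ i f) (∑-δ j f) ⟩
    f i xor f j
  ∎
  where
  disjoint-∨ : ∀ a b c → (a ≡ true → b ≡ true → ⊥) → (a ∨ b) ∧ c ≡ (a ∧ c) xor (b ∧ c)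
  disjoint-∨ true  true  c both = ⊥-elim (both refl refl)
  disjoint-∨ true  false c _    = sym (xor-identityʳ c)
  disjoint-∨ false b     c _    = refl

-- if (a b; b d)(p q; r s) = I over F₂ then the determinant ad − b² = ad + b is 1
det₂-unit : ∀ a b d p q r s → (a ∧ p) xor (b ∧ r) ≡ true → (a ∧ q) xor (b ∧ s) ≡ false →
  (b ∧ p) xor (d ∧ r) ≡ false → (b ∧ q) xor (d ∧ s) ≡ true → (a ∧ d) xor b ≡ true
det₂-unit false false false p q r s () _ _ _
det₂-unit false false true  p q r s () _ _ _
det₂-unit true  false false p q r s _  _ _ ()
det₂-unit true  true  true  p q r s e₁ _ e₃ _ with trans (sym e₁) e₃
... | ()
det₂-unit false true  false p q r s _ _ _ _ = refl
det₂-unit false true  true  p q r s _ _ _ _ = refl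
det₂-unit true  false true  p q r s _ _ _ _ = refl
det₂-unit true  true  false p q r s _ _ _ _ = refl

cross-cancel : ∀ x y → (x ∧ y) xor (y ∧ x) ≡ false
cross-cancel x y = trans (cong ((x ∧ y) xor_) (∧-comm y x)) (xor-same (x ∧ y))

pair-invertible⇒det : (A : Matrix n) → Symmetric A → {i j : Fin n} → ¬ i ≡ j →
  InvertibleOn (pair i j) A → (A i i ∧ A j j) xor A i j ≡ true
pair-invertible⇒det A symA {i} {j} i≢j (B , AB=I , _) =
  det₂-unit (A i i) (A i j) (A j j) (B i i) (B i j) (B j i) (B j j)
    (trans (entry i i i∈ i∈) (δ-refl i))
    (trans (entry i j i∈ j∈) (δ-≢ i≢j))
    (trans (cong (λ a → (a ∧ B i i) xor (A j j ∧ B j i)) (symA i j)) (trans (entry j i j∈ i∈) (δ-≢ (i≢j ∘ sym))))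
    (trans (cong (λ a → (a ∧ B i j) xor (A j j ∧ B j j)) (symA i j)) (trans (entry j j j∈ j∈) (δ-refl j)))
  where
  i∈ : mem (pair i j) i ≡ true
  i∈ = left∈pair i j
  j∈ : mem (pair i j) j ≡ true
  j∈ = right∈pair i j
  entry : ∀ p q → mem (pair i j) p ≡ true → mem (pair i j) q ≡ true →
    (A p i ∧ B i q) xor (A p j ∧ B j q) ≡ δ p q
  entry p q p∈ q∈ = trans (sym (ΣF-pair i≢j _)) (AB=I p q p∈ q∈)

-- ... and conversely, the adjugate (A_jj A_ij ; A_ij A_ii) is then an inverse
det⇒pair-invertible : (A : Matrix n) → Symmetric A → {i j : Fin n} → ¬ i ≡ j →
  (A i i ∧ A j j) xor A i j ≡ true → InvertibleOn (pair i j) A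
det⇒pair-invertible {n} A symA {i} {j} i≢j det = adjugate , rightInverse⇒inverse (pair i j) A adjugate symA AB=I
  where
  -- entries outside {i, j} are irrelevant
  adjugate : Matrix n
  adjugate p q = if δ i p then (if δ i q then A j j else A i j) else (if δ i q then A i j else A i i)
  adj-ii : adjugate i i ≡ A j j
  adj-ii rewrite δ-refl i = refl
  adj-ij : adjugate i j ≡ A i j
  adj-ij rewrite δ-refl i | δ-≢ i≢j = refl
  adj-ji : adjugate j i ≡ A i j
  adj-ji rewrite δ-refl i | δ-≢ i≢j = refl
  adj-jj : adjugate j j ≡ A i i
  adj-jj rewrite δ-≢ i≢j = refl
  entry : ∀ p q → ∑⟨ mem (pair i j) ⟩ (λ k → A p k ∧ adjugate k q) ≡ (A p i ∧ adjugate i q) xor (A p j ∧ adjugate j q)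
  entry p q = trans (sym (ΣF≡∑⟨mem⟩ (pair i j) _)) (ΣF-pair i≢j _)
  AB=I : RightInverseOn (mem (pair i j)) A adjugate
  AB=I p q p∈ q∈ with ∈-pair i j p p∈ | ∈-pair i j q q∈
  ... | inj₁ refl | inj₁ refl = begin
    _                                     ≡⟨ entry i i ⟩
    (A i i ∧ _) xor (A i j ∧ _)           ≡⟨ cong₂ (λ a b → (A i i ∧ a) xor (A i j ∧ b)) adj-ii adj-ji ⟩
    (A i i ∧ A j j) xor (A i j ∧ A i j)   ≡⟨ cong ((A i i ∧ A j j) xor_) (∧-idem (A i j)) ⟩
    (A i i ∧ A j j) xor A i j             ≡⟨ trans det (sym (δ-refl i)) ⟩
    δ i i                                 ∎
  ... | inj₁ refl | inj₂ refl = begin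
    _                                     ≡⟨ entry i j ⟩
    (A i i ∧ _) xor (A i j ∧ _)           ≡⟨ cong₂ (λ a b → (A i i ∧ a) xor (A i j ∧ b)) adj-ij adj-jj ⟩
    (A i i ∧ A i j) xor (A i j ∧ A i i)   ≡⟨ trans (cross-cancel (A i i) (A i j)) (sym (δ-≢ i≢j)) ⟩
    δ i j                                 ∎
  ... | inj₂ refl | inj₁ refl = begin
    _                                     ≡⟨ entry j i ⟩
    (A j i ∧ _) xor (A j j ∧ _)           ≡⟨ cong₂ (λ a b → (A j i ∧ a) xor (A j j ∧ b)) adj-ii adj-ji ⟩
    (A j i ∧ A j j) xor (A j j ∧ A i j)   ≡⟨ cong (λ a → (A j i ∧ A j j) xor (A j j ∧ a)) (sym (symA j i)) ⟩
    (A j i ∧ A j j) xor (A j j ∧ A j i)   ≡⟨ trans (cross-cancel (A j i) (A j j)) (sym (δ-≢ (i≢j ∘ sym))) ⟩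
    δ j i                                 ∎
  ... | inj₂ refl | inj₂ refl = begin
    _                                     ≡⟨ entry j j ⟩
    (A j i ∧ _) xor (A j j ∧ _)           ≡⟨ cong₂ (λ a b → (A j i ∧ a) xor (A j j ∧ b)) adj-ij adj-jj ⟩
    (A j i ∧ A i j) xor (A j j ∧ A i i)   ≡⟨ cong₂ (λ a b → (a ∧ A i j) xor b) (sym (symA i j)) (∧-comm (A j j) (A i i)) ⟩
    (A i j ∧ A i j) xor (A i i ∧ A j j)   ≡⟨ cong (_xor (A i i ∧ A j j)) (∧-idem (A i j)) ⟩
    A i j xor (A i i ∧ A j j)             ≡⟨ trans (xor-comm (A i j) _) (trans det (sym (δ-refl j))) ⟩
    δ j j                                 ∎

edge⇔pivotal : (A : Matrix n) → Symmetric A → {i j : Fin n} → ¬ i ≡ j →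
  (A i i ∧ A j j) xor A i j ≡ true ⇔ InvertibleOn (pair i j) A
edge⇔pivotal A symA i≢j = mk⇔ (det⇒pair-invertible A symA i≢j) (pair-invertible⇒det A symA i≢j)

ℛ₀-determines-loops : (H₁ H₂ : Graph n) → ℛ₀ H₁ ≐ ℛ₀ H₂ → ∀ i → adj H₁ i i ≡ adj H₂ i i
ℛ₀-determines-loops H₁ H₂ same i = ⇔-true⇒≡ (⇔-trans (loop⇔pivotal (adj H₁) i)
  (⇔-trans (same (singleton i)) (⇔-sym (loop⇔pivotal (adj H₂) i))))

ℛ₀-determines-graph : (H₁ H₂ : Graph n) → ℛ₀ H₁ ≐ ℛ₀ H₂ → ∀ i j → adj H₁ i j ≡ adj H₂ i j
ℛ₀-determines-graph H₁ H₂ same i j with i ≟ j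
... | yes refl = ℛ₀-determines-loops H₁ H₂ same i
... | no i≢j = xor-injectiveʳ (adj H₂ i i ∧ adj H₂ j j) (⇔-true⇒≡ (⇔-trans
    (subst (λ d → (d xor adj H₁ i j ≡ true) ⇔ InvertibleOn (pair i j) (adj H₁)) same-diagonal
           (edge⇔pivotal (adj H₁) (symm H₁) i≢j))
    (⇔-trans (same (pair i j)) (⇔-sym (edge⇔pivotal (adj H₂) (symm H₂) i≢j)))))
  where
  same-diagonal : adj H₁ i i ∧ adj H₁ j j ≡ adj H₂ i i ∧ adj H₂ j j
  same-diagonal = cong₂ _∧_ (ℛ₀-determines-loops H₁ H₂ same i) (ℛ₀-determines-loops H₁ H₂ same j)

-- The empty set is pivotal in every graph, so it pins down W in a realization of ℛ₀(G) ⊕ W.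

∅-pivotal : (H : Graph n) → ℛ₀ H ∅
∅-pivotal {n} H = adj H , (λ i _ i∈ _ → absurd i i∈) , (λ i _ i∈ _ → absurd i i∈)
  where
  absurd : ∀ {X : Set} (i : Fin n) → mem ∅ i ≡ true → X
  absurd i i∈ with trans (sym (lookup-replicate i false)) i∈
  ... | ()

∅≡⊕ˢ⇒≡ : {Y W : Subset n} → ∅ ≡ Y ⊕ˢ W → Y ≡ W
∅≡⊕ˢ⇒≡ {Y = Y} {W} e = subset-ext (λ k → xor-false⇒≡
  (trans (sym (mem-⊕ˢ Y W k)) (trans (cong (λ V → mem V k) (sym e)) (lookup-replicate k false))))

mainTheorem13 : ∀ {n} (G : Graph n) (W : Subset n) →
    (Realizable (ℛ₀ G ⊕ᶜ W) ⇔ ℛ₀ G W) ×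
    (∀ (B : Matrix n) → IsInverseOn W (adj G) B →
      ∀ (H : Graph n) → ℛ₀ H ≐ (ℛ₀ G ⊕ᶜ W) →
      ∀ i j → adj H i j ≡ pivot (adj G) W B i j)
mainTheorem13 G W = mk⇔ realizable⇒pivotal pivotal⇒realizable , realized-by-pivot
  where
  -- ∅ ∈ ℛ₀(H) = ℛ₀(G) ⊕ W gives ∅ = Y ⊕ W with Y ∈ ℛ₀(G), i.e. W = Y
  realizable⇒pivotal : Realizable (ℛ₀ G ⊕ᶜ W) → ℛ₀ G W
  realizable⇒pivotal (H , realizes) with Equivalence.to (realizes ∅) (∅-pivotal H)
  ... | Y , Y-pivotal , ∅≡Y⊕W = subst (ℛ₀ G) (∅≡⊕ˢ⇒≡ ∅≡Y⊕W) Y-pivotal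

  pivotal⇒realizable : ℛ₀ G W → Realizable (ℛ₀ G ⊕ᶜ W)
  pivotal⇒realizable (B , inv) = Pivot.pivotGraph G W B inv , Pivot.pivot-realizes G W B inv

  realized-by-pivot : ∀ B → IsInverseOn W (adj G) B → ∀ H → ℛ₀ H ≐ (ℛ₀ G ⊕ᶜ W) →
    ∀ i j → adj H i j ≡ pivot (adj G) W B i j
  realized-by-pivot B inv H realizes = ℛ₀-determines-graph H (Pivot.pivotGraph G W B inv)
    (λ U → ⇔-trans (realizes U) (⇔-sym (Pivot.pivot-realizes G W B inv U)))
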